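{- Let $i_1, i_2, D \in \mathbb{N}_0$, $A \in \mathbb{N}_+$, $\kappa_1, \kappa_2 \in \mathbb{N}_0$, and $i = i_1 + i_2$. Let $$(j_1, \tilde{\Delta}_1) = \mathrm{ds}(i_1, D, A, \kappa_1, 0), \qquad (j_2, \tilde{\Delta}_2) = \mathrm{ds}(i_2, D, A, \kappa_2, \tilde{\Delta}_1).$$ Then $j = j_1 + j_2$ is a nearest integer solution to $i\frac{D}{A}$ and $\tilde{\Delta}_2 = jA - iD$.
   Context: $\mathbb{N}_0$ denotes the set of non-negative integers and $\mathbb{N}_+$ the set of positive integers. Given $i, D \in \mathbb{N}_0$ and $A \in \mathbb{N}_+$, an integer $j \in \mathbb{N}_0$ is called a nearest integer solution to $i\frac{D}{A}$ if $j \in \arg\min_{k \in \mathbb{N}_0} \left| k - i\frac{D}{A} \right|$ (there may be up to two such $j$). For $x \in \mathbb{N}_0$, $x \bmod A \in \{0,\ldots,A-1\}$ is the remainder on division by $A$. The function $\mathrm{ds}(i, D, A, k_0, \Delta_-)$, with integer inputs $k_0$ and $\Delta_-$, returns a pair of integers computed as follows. Set $\Delta_0 := (k_0 - i)A + i(A - D) + \Delta_-$. Case 1: if $\Delta_0 = 0$, return $(k_0, \Delta_0)$. Case 2: if $\Delta_0 > 0$, set $k_1 := k_0 - \lfloor \Delta_0 / A \rfloor$ and $\Delta_1 := \Delta_0 \bmod A$; if $|\Delta_1 - A| < |\Delta_1|$ return $(k_1 - 1, \Delta_1 - A)$, otherwise return $(k_1, \Delta_1)$. Case 3: if $\Delta_0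 < 0$, set $k_1 := k_0 + \lfloor |\Delta_0| / A \rfloor$ and $\Delta_1 := -(|\Delta_0| \bmod A)$; if $|\Delta_1 + A| < |\Delta_1|$ return $(k_1 + 1, \Delta_1 + A)$, otherwise return $(k_1, \Delta_1)$. -}

module Defs where

open import Data.Nat as ℕ using (ℕ; NonZero)
open import Data.Nat.DivMod using (_/_; _%_)
open import Data.Integer as ℤ using (ℤ; +_; -[1+_])
open import Data.Rational as ℚ using (ℚ)
open import Data.Product using (_×_; _,_)
open import Relation.Nullary using (yes; no)

IsNearestIntegerSolution : (i D A : ℕ) .{{_ : NonZero A}} → ℕ → Set
IsNearestIntegerSolution i D A j =
  (k : ℕ) → ℚ.∣ (+ j ℚ./ 1) ℚ.- (+ (i ℕ.* D) ℚ./ A) ∣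
            ℚ.≤ ℚ.∣ (+ k ℚ./ 1) ℚ.- (+ (i ℕ.* D) ℚ./ A) ∣

ds : (i D A : ℕ) .{{_ : NonZero A}} → ℤ → ℤ → ℤ × ℤ
ds i D A k₀ Δ₋ = go Δ₀
  where
  Δ₀ : ℤ
  Δ₀ = ((k₀ ℤ.- + i) ℤ.* + A) ℤ.+ (+ i ℤ.* (+ A ℤ.- + D)) ℤ.+ Δ₋
  go : ℤ → ℤ × ℤ
  go (+ 0) = (k₀ , + 0)
  go (+ (ℕ.suc n)) with ℤ.∣ + (ℕ.suc n % A) ℤ.- + A ∣ ℕ.<? ℤ.∣ + (ℕ.suc n % A) ∣
  ... | yes _ = ((k₀ ℤ.- + (ℕ.suc n / A)) ℤ.- + 1 , + (ℕ.suc n % A) ℤ.- + A)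
  ... | no  _ = (k₀ ℤ.- + (ℕ.suc n / A) , + (ℕ.suc n % A))
  go -[1+ n ] with ℤ.∣ ℤ.- + (ℕ.suc n % A) ℤ.+ + A ∣ ℕ.<? ℤ.∣ ℤ.- + (ℕ.suc n % A) ∣
  ... | yes _ = ((k₀ ℤ.+ + (ℕ.suc n / A)) ℤ.+ + 1 , ℤ.- + (ℕ.suc n % A) ℤ.+ + A)
  ... | no  _ = (k₀ ℤ.+ + (ℕ.suc n / A) , ℤ.- + (ℕ.suc n % A))

module Submission where

-- Every pair (k, Δ) that ds can return satisfies Δ − kA = Δ₀ − k₀A = Δ₋ − iD, and of
-- the two remainders it chooses between, whose absolute values add up to A, it keeps
-- the smaller one, so 2|Δ| ≤ A. Feeding the remainder of the first call into the
-- second therefore gives Δ₂ = jA − iD with 2|jA − iD| ≤ A. For every other integer k,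
-- |kA − iD| ≥ |(k − j)A| − |jA − iD| ≥ A − |jA − iD| ≥ |jA − iD|, so j is a nearest
-- integer to iD/A; comparing with k = 0 also shows that j ≥ 0.

open import Defs
open import Data.Nat as ℕ using (ℕ; NonZero; suc)
open import Data.Integer as ℤ using (ℤ; +_; -[1+_]; ∣_∣)
open import Data.Product using (Σ; _×_; _,_; proj₁; proj₂)
open import Relation.Binary.PropositionalEquality

import Data.Nat.Properties as ℕ
open import Data.Nat.DivMod using (_/_; _%_; m≡m%n+[m/n]*n; m%n<n)
import Data.Integer.Properties as ℤ
open import Data.Integer.Tactic.RingSolver using (solve-∀; solve)
open import Data.List using (_∷_; [])
import Data.Rational as ℚ
import Data.Rational.Properties as ℚ
open import Data.Rational.Unnormalised as ℚᵘ using (mkℚᵘ; *≡*; *≤*)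
import Data.Rational.Unnormalised.Properties as ℚᵘ
open import Data.Empty using (⊥-elim)
open import Function using (_∘_)
open import Relation.Nullary using (yes; no; ¬_)

m≤n⇒m+n≡o⇒m+m≤o : ∀ {m n o} → m ℕ.≤ n → m ℕ.+ n ≡ o → m ℕ.+ m ℕ.≤ o
m≤n⇒m+n≡o⇒m+m≤o {m} m≤n refl = ℕ.+-monoʳ-≤ m m≤n

n≤m⇒m+n≡o⇒n+n≤o : ∀ {m n o} → n ℕ.≤ m → m ℕ.+ n ≡ o → n ℕ.+ n ℕ.≤ o
n≤m⇒m+n≡o⇒n+n≤o {n = n} n≤m refl = ℕ.+-monoˡ-≤ n n≤m

∣m-n∣+∣m∣≡n : ∀ {m n} → m ℕ.≤ n → ∣ + m ℤ.- + n ∣ ℕ.+ ∣ + m ∣ ≡ n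
∣m-n∣+∣m∣≡n {m} {n} m≤n = begin
  ∣ + m ℤ.- + n ∣ ℕ.+ m  ≡⟨ cong (λ x → ∣ x ∣ ℕ.+ m) (ℤ.m-n≡m⊖n m n) ⟩
  ∣ m ℤ.⊖ n ∣ ℕ.+ m      ≡⟨ cong (ℕ._+ m) (ℤ.∣⊖∣-≤ m≤n) ⟩
  n ℕ.∸ m ℕ.+ m          ≡⟨ ℕ.m∸n+n≡m m≤n ⟩
  n                      ∎
  where open ≡-Reasoning

∣-m+n∣+∣-m∣≡n : ∀ {m n} → m ℕ.≤ n → ∣ ℤ.- + m ℤ.+ + n ∣ ℕ.+ ∣ ℤ.- + m ∣ ≡ n
∣-m+n∣+∣-m∣≡n {m} {n} m≤n = begin
  ∣ ℤ.- + m ℤ.+ + n ∣ ℕ.+ ∣ ℤ.- + m ∣  ≡⟨ cong₂ ℕ._+_ ∣-m+n∣≡∣m-n∣ (ℤ.∣-i∣≡∣i∣ (+ m)) ⟩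
  ∣ + m ℤ.- + n ∣ ℕ.+ ∣ + m ∣          ≡⟨ ∣m-n∣+∣m∣≡n m≤n ⟩
  n                                    ∎
  where
  open ≡-Reasoning
  ∣-m+n∣≡∣m-n∣ : ∣ ℤ.- + m ℤ.+ + n ∣ ≡ ∣ + m ℤ.- + n ∣
  ∣-m+n∣≡∣m-n∣ = trans (cong ∣_∣ (ℤ.+-comm (ℤ.- + m) (+ n))) (ℤ.∣i-j∣≡∣j-i∣ (+ n) (+ m))

+m≡+[m%n]+[m/n]*n : ∀ m n .{{_ : NonZero n}} → + m ≡ + (m % n) ℤ.+ + (m / n) ℤ.* + n
+m≡+[m%n]+[m/n]*n m n = begin
  + m                                ≡⟨ cong +_ (m≡m%n+[m/n]*n m n) ⟩
  + (m % n ℕ.+ m / n ℕ.* n)          ≡⟨ cong (λ x → + (m % n) ℤ.+ x) (ℤ.pos-* (m / n) n) ⟩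
  + (m % n) ℤ.+ + (m / n) ℤ.* + n    ∎
  where open ≡-Reasoning

Centred : ℕ → ℤ → Set
Centred A Δ = ∣ Δ ∣ ℕ.+ ∣ Δ ∣ ℕ.≤ A

centred-minimal : ∀ A j k m → Centred A (j ℤ.* + A ℤ.- m) →
  ∣ j ℤ.* + A ℤ.- m ∣ ℕ.≤ ∣ k ℤ.* + A ℤ.- m ∣
centred-minimal A j k m centred with k ℤ.≟ j
... | yes refl = ℕ.≤-refl
... | no k≢j = ℕ.+-cancelʳ-≤ (∣ e ∣) (∣ e ∣) (∣ f ∣) (begin
  ∣ e ∣ ℕ.+ ∣ e ∣           ≤⟨ centred ⟩
  A                         ≤⟨ ℕ.m≤n*m A ∣ k ℤ.- j ∣ {{∣k-j∣≢0}} ⟩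
  ∣ k ℤ.- j ∣ ℕ.* A         ≡⟨ ℤ.abs-* (k ℤ.- j) (+ A) ⟨
  ∣ (k ℤ.- j) ℤ.* + A ∣     ≡⟨ cong ∣_∣ ([k-j]a≡[ka-m]-[ja-m] k j m (+ A)) ⟩
  ∣ f ℤ.- e ∣               ≤⟨ ℤ.∣i-j∣≤∣i∣+∣j∣ f e ⟩
  ∣ f ∣ ℕ.+ ∣ e ∣           ∎)
  where
  open ℕ.≤-Reasoning
  e f : ℤ
  e = j ℤ.* + A ℤ.- m
  f = k ℤ.* + A ℤ.- m
  [k-j]a≡[ka-m]-[ja-m] : ∀ k j m a → (k ℤ.- j) ℤ.* a ≡ (k ℤ.* a ℤ.- m) ℤ.- (j ℤ.* a ℤ.- m)
  [k-j]a≡[ka-m]-[ja-m] = solve-∀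
  ∣k-j∣≢0 : NonZero ∣ k ℤ.- j ∣
  ∣k-j∣≢0 = ℕ.≢-nonZero (k≢j ∘ ℤ.i-j≡0⇒i≡j k j ∘ ℤ.∣i∣≡0⇒i≡0)

centred⇒nonNegative : ∀ A .{{_ : NonZero A}} j m → Centred A (j ℤ.* + A ℤ.- + m) →
  Σ ℕ (λ n → j ≡ + n)
centred⇒nonNegative A (+ n)    m _       = n , refl
centred⇒nonNegative A -[1+ t ] m centred = ⊥-elim (ℕ.<⇒≱ m<∣e∣ (begin
  ∣ -[1+ t ] ℤ.* + A ℤ.- + m ∣  ≤⟨ centred-minimal A -[1+ t ] (+ 0) (+ m) centred ⟩
  ∣ + 0 ℤ.* + A ℤ.- + m ∣       ≡⟨ cong ∣_∣ (ℤ.+-identityˡ (ℤ.- + m)) ⟩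
  ∣ ℤ.- + m ∣                   ≡⟨ ℤ.∣-i∣≡∣i∣ (+ m) ⟩
  m                             ∎))
  where
  open ℕ.≤-Reasoning
  -x*a-y≡-[x*a+y] : ∀ x a y → ℤ.- x ℤ.* a ℤ.- y ≡ ℤ.- (x ℤ.* a ℤ.+ y)
  -x*a-y≡-[x*a+y] = solve-∀
  m<∣e∣ : m ℕ.< ∣ -[1+ t ] ℤ.* + A ℤ.- + m ∣
  m<∣e∣ = begin-strict
    m                                  <⟨ ℕ.m<n+m m (ℕ.<-≤-trans (ℕ.>-nonZero⁻¹ A) (ℕ.m≤n*m A (suc t))) ⟩
    suc t ℕ.* A ℕ.+ m                  ≡⟨ cong (λ x → ∣ x ℤ.+ + m ∣) (ℤ.pos-* (suc t) A) ⟩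
    ∣ + suc t ℤ.* + A ℤ.+ + m ∣        ≡⟨ ℤ.∣-i∣≡∣i∣ (+ suc t ℤ.* + A ℤ.+ + m) ⟨
    ∣ ℤ.- (+ suc t ℤ.* + A ℤ.+ + m) ∣  ≡⟨ cong ∣_∣ (-x*a-y≡-[x*a+y] (+ suc t) (+ A) (+ m)) ⟨
    ∣ -[1+ t ] ℤ.* + A ℤ.- + m ∣       ∎

p/1-q/n≃[pn-q]/n : ∀ p q a → mkℚᵘ p 0 ℚᵘ.- mkℚᵘ q a ℚᵘ.≃ mkℚᵘ (p ℤ.* + suc a ℤ.- q) a
p/1-q/n≃[pn-q]/n p q a rewrite ℕ.+-identityʳ a = *≡* ([pn-q]n≡[pn-q]n p q (+ suc a))
  where
  [pn-q]n≡[pn-q]n : ∀ p q n → (p ℤ.* n ℤ.+ ℤ.- q ℤ.* + 1) ℤ.* n ≡ (p ℤ.* n ℤ.- q) ℤ.* n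
  [pn-q]n≡[pn-q]n = solve-∀

toℚᵘ-∣p/1-q/n∣ : ∀ p q a →
  ℚ.toℚᵘ ℚ.∣ p ℚ./ 1 ℚ.- q ℚ./ suc a ∣ ℚᵘ.≃ mkℚᵘ (+ ∣ p ℤ.* + suc a ℤ.- q ∣) a
toℚᵘ-∣p/1-q/n∣ p q a = begin
  ℚ.toℚᵘ ℚ.∣ x ℚ.- y ∣                ≈⟨ ℚ.toℚᵘ-homo-∣-∣ (x ℚ.- y) ⟩
  ℚᵘ.∣ ℚ.toℚᵘ (x ℚ.+ ℚ.- y) ∣          ≈⟨ ℚᵘ.∣-∣-cong (ℚ.toℚᵘ-homo-+ x (ℚ.- y)) ⟩
  ℚᵘ.∣ ℚ.toℚᵘ x ℚᵘ.+ ℚ.toℚᵘ (ℚ.- y) ∣  ≈⟨ ℚᵘ.∣-∣-cong (ℚᵘ.+-cong (ℚ.toℚᵘ-fromℚᵘ (mkℚᵘ p 0)) toℚᵘ-y) ⟩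
  ℚᵘ.∣ mkℚᵘ p 0 ℚᵘ.- mkℚᵘ q a ∣       ≈⟨ ℚᵘ.∣-∣-cong (p/1-q/n≃[pn-q]/n p q a) ⟩
  mkℚᵘ (+ ∣ p ℤ.* + suc a ℤ.- q ∣) a  ∎
  where
  open ℚᵘ.≃-Reasoning
  x = p ℚ./ 1
  y = q ℚ./ suc a
  toℚᵘ-y : ℚ.toℚᵘ (ℚ.- y) ℚᵘ.≃ ℚᵘ.- mkℚᵘ q a
  toℚᵘ-y = ℚᵘ.≃-trans (ℚ.toℚᵘ-homo‿- y) (ℚᵘ.-‿cong (ℚ.toℚᵘ-fromℚᵘ (mkℚᵘ q a)))

∣p/1-q/n∣-mono-≤ : ∀ p p′ q a → ∣ p ℤ.* + suc a ℤ.- q ∣ ℕ.≤ ∣ p′ ℤ.* + suc a ℤ.- q ∣ →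
  ℚ.∣ p ℚ./ 1 ℚ.- q ℚ./ suc a ∣ ℚ.≤ ℚ.∣ p′ ℚ./ 1 ℚ.- q ℚ./ suc a ∣
∣p/1-q/n∣-mono-≤ p p′ q a le = ℚ.toℚᵘ-cancel-≤
  (ℚᵘ.≤-respˡ-≃ (ℚᵘ.≃-sym (toℚᵘ-∣p/1-q/n∣ p q a))
  (ℚᵘ.≤-respʳ-≃ (ℚᵘ.≃-sym (toℚᵘ-∣p/1-q/n∣ p′ q a))
  (*≤* (ℤ.*-monoʳ-≤-nonNeg (+ suc a) (ℤ.+≤+ le)))))

centred⇒nearest : ∀ i D a j → Centred (suc a) (j ℤ.* + suc a ℤ.- + (i ℕ.* D)) →
  Σ ℕ (λ n → (j ≡ + n) × IsNearestIntegerSolution i D (suc a) n)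
centred⇒nearest i D a j centred with centred⇒nonNegative (suc a) j (i ℕ.* D) centred
... | n , refl = n , refl , λ k → ∣p/1-q/n∣-mono-≤ (+ n) (+ k) (+ (i ℕ.* D)) a
                                    (centred-minimal (suc a) (+ n) (+ k) (+ (i ℕ.* D)) centred)

module _ (a k₀ q r : ℤ) {x : ℤ} (x≡r+qa : x ≡ r ℤ.+ q ℤ.* a) where
  open ≡-Reasoning

  floor⁺-shift : r ℤ.- (k₀ ℤ.- q) ℤ.* a ≡ x ℤ.- k₀ ℤ.* a
  floor⁺-shift = begin
    r ℤ.- (k₀ ℤ.- q) ℤ.* a        ≡⟨ solve (a ∷ k₀ ∷ q ∷ r ∷ []) ⟩
    (r ℤ.+ q ℤ.* a) ℤ.- k₀ ℤ.* a  ≡⟨ cong (ℤ._- k₀ ℤ.* a) (sym x≡r+qa) ⟩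
    x ℤ.- k₀ ℤ.* a                ∎

  ceil⁺-shift : (r ℤ.- a) ℤ.- ((k₀ ℤ.- q) ℤ.- + 1) ℤ.* a ≡ x ℤ.- k₀ ℤ.* a
  ceil⁺-shift = begin
    (r ℤ.- a) ℤ.- ((k₀ ℤ.- q) ℤ.- + 1) ℤ.* a  ≡⟨ solve (a ∷ k₀ ∷ q ∷ r ∷ []) ⟩
    (r ℤ.+ q ℤ.* a) ℤ.- k₀ ℤ.* a              ≡⟨ cong (ℤ._- k₀ ℤ.* a) (sym x≡r+qa) ⟩
    x ℤ.- k₀ ℤ.* a                            ∎

  floor⁻-shift : ℤ.- r ℤ.- (k₀ ℤ.+ q) ℤ.* a ≡ ℤ.- x ℤ.- k₀ ℤ.* a
  floor⁻-shift = begin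
    ℤ.- r ℤ.- (k₀ ℤ.+ q) ℤ.* a        ≡⟨ solve (a ∷ k₀ ∷ q ∷ r ∷ []) ⟩
    ℤ.- (r ℤ.+ q ℤ.* a) ℤ.- k₀ ℤ.* a  ≡⟨ cong (λ y → ℤ.- y ℤ.- k₀ ℤ.* a) (sym x≡r+qa) ⟩
    ℤ.- x ℤ.- k₀ ℤ.* a                ∎

  ceil⁻-shift : (ℤ.- r ℤ.+ a) ℤ.- ((k₀ ℤ.+ q) ℤ.+ + 1) ℤ.* a ≡ ℤ.- x ℤ.- k₀ ℤ.* a
  ceil⁻-shift = begin
    (ℤ.- r ℤ.+ a) ℤ.- ((k₀ ℤ.+ q) ℤ.+ + 1) ℤ.* a  ≡⟨ solve (a ∷ k₀ ∷ q ∷ r ∷ []) ⟩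
    ℤ.- (r ℤ.+ q ℤ.* a) ℤ.- k₀ ℤ.* a              ≡⟨ cong (λ y → ℤ.- y ℤ.- k₀ ℤ.* a) (sym x≡r+qa) ⟩
    ℤ.- x ℤ.- k₀ ℤ.* a                            ∎

CentredRemainder : (A : ℕ) (k₀ x : ℤ) → ℤ × ℤ → Set
CentredRemainder A k₀ x r = (proj₂ r ℤ.- proj₁ r ℤ.* + A ≡ x ℤ.- k₀ ℤ.* + A) × Centred A (proj₂ r)

module _ (A : ℕ) .{{_ : NonZero A}} (k₀ : ℤ) (S : ℕ) where
  private
    r≤A : S % A ℕ.≤ A
    r≤A = ℕ.<⇒≤ (m%n<n S A)

    S≡r+qA : + S ≡ + (S % A) ℤ.+ + (S / A) ℤ.* + A
    S≡r+qA = +m≡+[m%n]+[m/n]*n S A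

  ceil⁺-candidate : ∣ + (S % A) ℤ.- + A ∣ ℕ.< ∣ + (S % A) ∣ →
    CentredRemainder A k₀ (+ S) ((k₀ ℤ.- + (S / A)) ℤ.- + 1 , + (S % A) ℤ.- + A)
  ceil⁺-candidate p = ceil⁺-shift (+ A) k₀ (+ (S / A)) (+ (S % A)) S≡r+qA
                    , m≤n⇒m+n≡o⇒m+m≤o (ℕ.<⇒≤ p) (∣m-n∣+∣m∣≡n r≤A)

  floor⁺-candidate : ¬ ∣ + (S % A) ℤ.- + A ∣ ℕ.< ∣ + (S % A) ∣ →
    CentredRemainder A k₀ (+ S) (k₀ ℤ.- + (S / A) , + (S % A))
  floor⁺-candidate ¬p = floor⁺-shift (+ A) k₀ (+ (S / A)) (+ (S % A)) S≡r+qA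
                      , n≤m⇒m+n≡o⇒n+n≤o (ℕ.≮⇒≥ ¬p) (∣m-n∣+∣m∣≡n r≤A)

  ceil⁻-candidate : ∣ ℤ.- + (S % A) ℤ.+ + A ∣ ℕ.< ∣ ℤ.- + (S % A) ∣ →
    CentredRemainder A k₀ (ℤ.- + S) ((k₀ ℤ.+ + (S / A)) ℤ.+ + 1 , ℤ.- + (S % A) ℤ.+ + A)
  ceil⁻-candidate p = ceil⁻-shift (+ A) k₀ (+ (S / A)) (+ (S % A)) S≡r+qA
                    , m≤n⇒m+n≡o⇒m+m≤o (ℕ.<⇒≤ p) (∣-m+n∣+∣-m∣≡n r≤A)

  floor⁻-candidate : ¬ ∣ ℤ.- + (S % A) ℤ.+ + A ∣ ℕ.< ∣ ℤ.- + (S % A) ∣ →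
    CentredRemainder A k₀ (ℤ.- + S) (k₀ ℤ.+ + (S / A) , ℤ.- + (S % A))
  floor⁻-candidate ¬p = floor⁻-shift (+ A) k₀ (+ (S / A)) (+ (S % A)) S≡r+qA
                      , n≤m⇒m+n≡o⇒n+n≤o (ℕ.≮⇒≥ ¬p) (∣-m+n∣+∣-m∣≡n r≤A)

-- The with-abstractions repeat those in the definition of ds verbatim, so that each
-- branch sees ds reduced to one of its four candidates.
ds-centred : ∀ i D A .{{_ : NonZero A}} k₀ Δ₋ →
  CentredRemainder A k₀ ((k₀ ℤ.- + i) ℤ.* + A ℤ.+ + i ℤ.* (+ A ℤ.- + D) ℤ.+ Δ₋) (ds i D A k₀ Δ₋)
ds-centred i D A k₀ Δ₋ with (k₀ ℤ.- + i) ℤ.* + A ℤ.+ + i ℤ.* (+ A ℤ.- + D) ℤ.+ Δ₋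
... | + 0 = refl , ℕ.z≤n
... | + suc n with ∣ + (suc n % A) ℤ.- + A ∣ ℕ.<? ∣ + (suc n % A) ∣
...   | yes p = ceil⁺-candidate A k₀ (suc n) p
...   | no ¬p = floor⁺-candidate A k₀ (suc n) ¬p
ds-centred i D A k₀ Δ₋ | -[1+ n ] with ∣ ℤ.- + (suc n % A) ℤ.+ + A ∣ ℕ.<? ∣ ℤ.- + (suc n % A) ∣
...   | yes p = ceil⁻-candidate A k₀ (suc n) p
...   | no ¬p = floor⁻-candidate A k₀ (suc n) ¬p

ds-remainder : ∀ i D A .{{_ : NonZero A}} k₀ Δ₋ → let r = ds i D A k₀ Δ₋ in
  proj₂ r ≡ proj₁ r ℤ.* + A ℤ.- + i ℤ.* + D ℤ.+ Δ₋
ds-remainder i D A k₀ Δ₋ = begin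
  Δ                                  ≡⟨ x≡[x-y]+y Δ (k ℤ.* + A) ⟩
  (Δ ℤ.- k ℤ.* + A) ℤ.+ k ℤ.* + A    ≡⟨ cong (ℤ._+ k ℤ.* + A) (proj₁ (ds-centred i D A k₀ Δ₋)) ⟩
  (Δ₀ ℤ.- k₀ ℤ.* + A) ℤ.+ k ℤ.* + A  ≡⟨ [Δ₀-k₀a]+ka≡ka-id+Δ₋ k k₀ (+ i) (+ A) (+ D) Δ₋ ⟩
  k ℤ.* + A ℤ.- + i ℤ.* + D ℤ.+ Δ₋   ∎
  where
  open ≡-Reasoning
  k Δ Δ₀ : ℤ
  k = proj₁ (ds i D A k₀ Δ₋)
  Δ = proj₂ (ds i D A k₀ Δ₋)
  Δ₀ = (k₀ ℤ.- + i) ℤ.* + A ℤ.+ + i ℤ.* (+ A ℤ.- + D) ℤ.+ Δ₋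
  x≡[x-y]+y : ∀ x y → x ≡ (x ℤ.- y) ℤ.+ y
  x≡[x-y]+y = solve-∀
  [Δ₀-k₀a]+ka≡ka-id+Δ₋ : ∀ k k₀ i a d Δ₋ →
    ((k₀ ℤ.- i) ℤ.* a ℤ.+ i ℤ.* (a ℤ.- d) ℤ.+ Δ₋ ℤ.- k₀ ℤ.* a) ℤ.+ k ℤ.* a ≡ k ℤ.* a ℤ.- i ℤ.* d ℤ.+ Δ₋
  [Δ₀-k₀a]+ka≡ka-id+Δ₋ = solve-∀

chained-ds-remainder : ∀ i₁ i₂ D A .{{_ : NonZero A}} k₁ k₂ →
  let r₁ = ds i₁ D A k₁ (+ 0)
      r₂ = ds i₂ D A k₂ (proj₂ r₁)
  in proj₂ r₂ ≡ (proj₁ r₁ ℤ.+ proj₁ r₂) ℤ.* + A ℤ.- + (i₁ ℕ.+ i₂) ℤ.* + D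
chained-ds-remainder i₁ i₂ D A k₁ k₂ = begin
  proj₂ r₂                                  ≡⟨ ds-remainder i₂ D A k₂ (proj₂ r₁) ⟩
  j₂ ℤ.* + A ℤ.- + i₂ ℤ.* + D ℤ.+ proj₂ r₁  ≡⟨ cong (λ Δ₁ → j₂ ℤ.* + A ℤ.- + i₂ ℤ.* + D ℤ.+ Δ₁)
                                                   (ds-remainder i₁ D A k₁ (+ 0)) ⟩
  j₂ ℤ.* + A ℤ.- + i₂ ℤ.* + D ℤ.+ (j₁ ℤ.* + A ℤ.- + i₁ ℤ.* + D ℤ.+ + 0)
                                            ≡⟨ sum-of-remainders j₁ j₂ (+ A) (+ i₁) (+ i₂) (+ D) ⟩
  (j₁ ℤ.+ j₂) ℤ.* + A ℤ.- (+ i₁ ℤ.+ + i₂) ℤ.* + D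
                                            ≡⟨ cong (λ x → (j₁ ℤ.+ j₂) ℤ.* + A ℤ.- x ℤ.* + D) (ℤ.pos-+ i₁ i₂) ⟨
  (j₁ ℤ.+ j₂) ℤ.* + A ℤ.- + (i₁ ℕ.+ i₂) ℤ.* + D
                                            ∎
  where
  open ≡-Reasoning
  r₁ = ds i₁ D A k₁ (+ 0)
  r₂ = ds i₂ D A k₂ (proj₂ r₁)
  j₁ j₂ : ℤ
  j₁ = proj₁ r₁
  j₂ = proj₁ r₂
  sum-of-remainders : ∀ j₁ j₂ a i₁ i₂ d →
    j₂ ℤ.* a ℤ.- i₂ ℤ.* d ℤ.+ (j₁ ℤ.* a ℤ.- i₁ ℤ.* d ℤ.+ + 0) ≡ (j₁ ℤ.+ j₂) ℤ.* a ℤ.- (i₁ ℤ.+ i₂) ℤ.* d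
  sum-of-remainders = solve-∀

lemma3 : (i₁ i₂ D A : ℕ) .{{_ : NonZero A}} (κ₁ κ₂ : ℕ) →
    let i = i₁ ℕ.+ i₂
        r₁ = ds i₁ D A (+ κ₁) (+ 0)
        r₂ = ds i₂ D A (+ κ₂) (proj₂ r₁)
        j = proj₁ r₁ ℤ.+ proj₁ r₂
    in Σ ℕ (λ n → (j ≡ + n) × IsNearestIntegerSolution i D A n)
       × (proj₂ r₂ ≡ (j ℤ.* + A) ℤ.- (+ i ℤ.* + D))
lemma3 i₁ i₂ D A@(suc a) κ₁ κ₂ = centred⇒nearest i D a j centred , Δ₂≡jA-iD
  where
  i = i₁ ℕ.+ i₂
  r₁ = ds i₁ D A (+ κ₁) (+ 0)
  r₂ = ds i₂ D A (+ κ₂) (proj₂ r₁)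
  j = proj₁ r₁ ℤ.+ proj₁ r₂
  Δ₂≡jA-iD : proj₂ r₂ ≡ j ℤ.* + A ℤ.- + i ℤ.* + D
  Δ₂≡jA-iD = chained-ds-remainder i₁ i₂ D A (+ κ₁) (+ κ₂)
  centred : Centred A (j ℤ.* + A ℤ.- + (i ℕ.* D))
  centred = subst (Centred A)
    (trans Δ₂≡jA-iD (cong (λ x → j ℤ.* + A ℤ.- x) (sym (ℤ.pos-* i D))))
    (proj₂ (ds-centred i₂ D A (+ κ₂) (proj₂ r₁)))
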